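{- Let $n,k$ be integers with $k\ge1$, $n>2k$, and both $n$ and $k$ odd. Then $\beta(P(n,k))\le n+\frac{k+1}{2}$.
   Context: $P(n,k)$ is the generalized Petersen graph with vertices $u_1,\dots,u_n,v_1,\dots,v_n$ and edges $u_iu_{i+1}$, $u_iv_i$, $v_iv_{i+k}$ (subscripts modulo $n$). $\beta(G)$ denotes the size of a minimum vertex cover of $G$. -}

module Defs where

open import Data.Nat using (ℕ; suc; _+_; _<_; NonZero)
open import Data.Nat.DivMod using (_%_; m%n<n)
open import Data.Fin using (Fin; toℕ; fromℕ<)
open import Data.Fin.Subset using (Subset; _∈_; ∣_∣)
open import Data.Sum using (_⊎_; inj₁; inj₂)

-- Vertices of P(n,k): inj₁ i is u_i, inj₂ i is v_i  (i ∈ {0,…,n-1}).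
PVertex : ℕ → Set
PVertex n = Fin n ⊎ Fin n

_+ₘ_ : ∀ {n} .{{_ : NonZero n}} → Fin n → ℕ → Fin n
_+ₘ_ {n} i j = fromℕ< (m%n<n (toℕ i + j) n)

data PEdge (n k : ℕ) .{{_ : NonZero n}} : PVertex n → PVertex n → Set where
  outer : ∀ i → PEdge n k (inj₁ i) (inj₁ (i +ₘ 1))
  spoke : ∀ i → PEdge n k (inj₁ i) (inj₂ i)
  inner : ∀ i → PEdge n k (inj₂ i) (inj₂ (i +ₘ k))

record VertexSet (n : ℕ) : Set where
  constructor ⟨_,_⟩
  field
    us : Subset n
    vs : Subset n

_∈V_ : ∀ {n} → PVertex n → VertexSet n → Set
inj₁ i ∈V S = i ∈ VertexSet.us S
inj₂ i ∈V S = i ∈ VertexSet.vs S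

size : ∀ {n} → VertexSet n → ℕ
size S = ∣ VertexSet.us S ∣ + ∣ VertexSet.vs S ∣

IsVertexCover : (n k : ℕ) .{{_ : NonZero n}} → VertexSet n → Set
IsVertexCover n k S = ∀ x y → PEdge n k x y → (x ∈V S) ⊎ (y ∈V S)

module Submission where

-- The cover S takes every outer vertex u_i with i even, and every inner
-- vertex v_i with i odd or i in the tail  n − k ≤ i < n.
--  * Outer edges u_i u_{i+1}: consecutive indices have opposite parity; the
--    only wrap-around edge u_{n-1} u_0 has n − 1 even.  Spokes u_i v_i: one of
--    u_i, v_i is chosen for either parity of i.  Inner edges v_i v_{i+k}: for
--    odd i take v_i; for even i either i + k < n is odd (no wrap-around), or
--    i lies in the tail.
--  * Size: outside the tail each index contributes exactly one vertex; in the
--    tail (of length k, starting at the even number n − k) each index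
--    contributes one inner vertex plus one outer vertex if it is even, and
--    there are ⌈k/2⌉ even offsets below k.

open import Defs
open import Data.Nat using (ℕ; suc; _+_; _*_; _≤_; _<_; NonZero)
open import Data.Nat.DivMod using (_/_)
open import Data.Product using (Σ; _×_)
open import Relation.Binary.PropositionalEquality using (_≡_)

open import Data.Bool using (Bool; true; false; not; _∨_)
open import Data.Bool.Properties using (∨-zeroʳ; ∨-identityʳ)
open import Data.Fin using (Fin; toℕ)
open import Data.Fin.Properties using (toℕ-fromℕ<; toℕ<n)
open import Data.Fin.Subset using (Subset; _∈_; ∣_∣)
open import Data.Nat using (zero; _∸_; ⌈_/2⌉; z≤n; s≤s; _≤?_; parity)
open import Data.Nat.DivMod using (m%n<n; m<n⇒m%n≡m; m/n≡1+[m∸n]/n)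
open import Data.Nat.Properties
open import Algebra.Properties.CommutativeSemigroup +-commutativeSemigroup using (interchange)
open import Data.Parity.Base as ℙ using (Parity; 0ℙ; 1ℙ)
open import Data.Parity.Properties as ℙₚ using (+-homo-+; *-homo-*)
open import Data.Product using (_,_)
open import Data.Sum using (inj₁; inj₂)
open import Data.Vec using (tabulate)
open import Data.Vec.Properties using (lookup⇒[]=; lookup∘tabulate)
open import Function using (_∘_)
open import Relation.Binary.PropositionalEquality
  using (refl; sym; trans; cong; cong₂; subst; module ≡-Reasoning)
open import Relation.Nullary using (contradiction; does; yes; no)
open import Relation.Nullary.Decidable using (dec-true; dec-false)

∑< : ℕ → (ℕ → ℕ) → ℕ
∑< zero    f = 0
∑< (suc m) f = f 0 + ∑< m (f ∘ suc)

⟦_⟧ : Bool → ℕ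
⟦ true  ⟧ = 1
⟦ false ⟧ = 0

∑<-cong : ∀ m {f g : ℕ → ℕ} → (∀ i → i < m → f i ≡ g i) → ∑< m f ≡ ∑< m g
∑<-cong zero    eq = refl
∑<-cong (suc m) eq = cong₂ _+_ (eq 0 (s≤s z≤n)) (∑<-cong m (λ i i<m → eq (suc i) (s≤s i<m)))

∑<-+ : ∀ m (f g : ℕ → ℕ) → ∑< m (λ i → f i + g i) ≡ ∑< m f + ∑< m g
∑<-+ zero    f g = refl
∑<-+ (suc m) f g =
  trans (cong ((f 0 + g 0) +_) (∑<-+ m (f ∘ suc) (g ∘ suc)))
        (interchange (f 0) (g 0) (∑< m (f ∘ suc)) (∑< m (g ∘ suc)))

∑<-const : ∀ m c → ∑< m (λ _ → c) ≡ m * c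
∑<-const zero    c = refl
∑<-const (suc m) c = cong (c +_) (∑<-const m c)

∑<-split : ∀ m l (f : ℕ → ℕ) → ∑< (m + l) f ≡ ∑< m f + ∑< l (λ j → f (m + j))
∑<-split zero    l f = refl
∑<-split (suc m) l f = trans (cong (f 0 +_) (∑<-split m l (f ∘ suc))) (sym (+-assoc (f 0) _ _))

subsetOf : ∀ n → (ℕ → Bool) → Subset n
subsetOf n p = tabulate (p ∘ toℕ)

∣subsetOf∣ : ∀ n (p : ℕ → Bool) → ∣ subsetOf n p ∣ ≡ ∑< n (⟦_⟧ ∘ p)
∣subsetOf∣ zero    p = refl
∣subsetOf∣ (suc n) p with p 0
... | true  = cong suc (∣subsetOf∣ n (p ∘ suc))
... | false = ∣subsetOf∣ n (p ∘ suc)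

∈subsetOf : ∀ {n} (p : ℕ → Bool) (i : Fin n) → p (toℕ i) ≡ true → i ∈ subsetOf n p
∈subsetOf {n} p i pi = lookup⇒[]= i (subsetOf n p) (trans (lookup∘tabulate (p ∘ toℕ) i) pi)

even? : Parity → Bool
even? 0ℙ = true
even? 1ℙ = false

isEven : ℕ → Bool
isEven = even? ∘ parity

parity-+ : ∀ m n {p q} → parity m ≡ p → parity n ≡ q → parity (m + n) ≡ p ℙ.+ q
parity-+ m n refl refl = +-homo-+ m n

parity-odd : ∀ b → parity (2 * b + 1) ≡ 1ℙ
parity-odd b = parity-+ (2 * b) 1 (*-homo-* 2 b) refl

parity-∸ : ∀ {n k} → k ≤ n → parity n ≡ 1ℙ → parity k ≡ 1ℙ → parity (n ∸ k) ≡ 0ℙ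
parity-∸ {n} {k} k≤n n-odd k-odd = ℙₚ.+-cancelʳ-≡ 1ℙ (parity (n ∸ k)) 0ℙ (begin
  parity (n ∸ k) ℙ.+ 1ℙ ≡⟨ sym (parity-+ (n ∸ k) k refl k-odd) ⟩
  parity (n ∸ k + k)    ≡⟨ cong parity (m∸n+n≡m k≤n) ⟩
  parity n              ≡⟨ n-odd ⟩
  1ℙ                    ∎)
  where open ≡-Reasoning

∑<-isEven : ∀ m → ∑< m (⟦_⟧ ∘ isEven) ≡ ⌈ m /2⌉
∑<-isEven zero          = refl
∑<-isEven (suc zero)    = refl
∑<-isEven (suc (suc m)) = cong suc (∑<-isEven m)

⌈m/2⌉≡[m+1]/2 : ∀ m → ⌈ m /2⌉ ≡ (m + 1) / 2
⌈m/2⌉≡[m+1]/2 zero          = refl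
⌈m/2⌉≡[m+1]/2 (suc zero)    = refl
⌈m/2⌉≡[m+1]/2 (suc (suc m)) =
  trans (cong suc (⌈m/2⌉≡[m+1]/2 m)) (sym (m/n≡1+[m∸n]/n {m = suc (suc m) + 1} (s≤s (s≤s z≤n))))

toℕ-+ₘ : ∀ {n} .{{_ : NonZero n}} (i : Fin n) j → toℕ i + j < n → toℕ (i +ₘ j) ≡ toℕ i + j
toℕ-+ₘ {n} i j lt = trans (toℕ-fromℕ< (m%n<n (toℕ i + j) n)) (m<n⇒m%n≡m lt)

innerChosen : ℕ → ℕ → ℕ → Bool
innerChosen n k i = not (isEven i) ∨ does (n ∸ k ≤? i)

cover : (n k : ℕ) → VertexSet n
cover n k = ⟨ subsetOf n isEven , subsetOf n (innerChosen n k) ⟩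

cover-isVertexCover : ∀ n k .{{_ : NonZero n}} → k ≤ n → parity n ≡ 1ℙ → parity k ≡ 1ℙ →
  IsVertexCover n k (cover n k)
cover-isVertexCover n k k≤n n-odd k-odd = covers
  where
    u∈cover : ∀ i → parity (toℕ i) ≡ 0ℙ → inj₁ i ∈V cover n k
    u∈cover i even = ∈subsetOf isEven i (cong even? even)

    v∈cover-odd : ∀ i → parity (toℕ i) ≡ 1ℙ → inj₂ i ∈V cover n k
    v∈cover-odd i odd =
      ∈subsetOf (innerChosen n k) i (cong (λ p → not (even? p) ∨ does (n ∸ k ≤? toℕ i)) odd)

    v∈cover-tail : ∀ i → n ∸ k ≤ toℕ i → inj₂ i ∈V cover n k
    v∈cover-tail i tail =
      ∈subsetOf (innerChosen n k) i (trans (cong (not (isEven (toℕ i)) ∨_) (dec-true (n ∸ k ≤? toℕ i) tail))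
                                            (∨-zeroʳ _))

    covers : IsVertexCover n k (cover n k)
    covers _ _ (outer i) with parity (toℕ i) in i-parity
    ... | 0ℙ = inj₁ (u∈cover i i-parity)
    ... | 1ℙ with m≤n⇒m<n∨m≡n (subst (_≤ n) (+-comm 1 (toℕ i)) (toℕ<n i))
    ...   | inj₁ lt   = inj₂ (u∈cover (i +ₘ 1) (trans (cong parity (toℕ-+ₘ i 1 lt)) (parity-+ (toℕ i) 1 i-parity refl)))
    ...   | inj₂ last = contradiction (trans (sym n-odd) n-even) (ℙₚ.p≢p⁻¹ 1ℙ)
      where
        -- The only wrap-around outer edge starts at index n − 1, which is even.
        n-even : parity n ≡ 0ℙ
        n-even = trans (cong parity (sym last)) (parity-+ (toℕ i) 1 i-parity refl)
    covers _ _ (spoke i) with parity (toℕ i) in i-parity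
    ... | 0ℙ = inj₁ (u∈cover i i-parity)
    ... | 1ℙ = inj₂ (v∈cover-odd i i-parity)
    covers _ _ (inner i) with parity (toℕ i) in i-parity
    ... | 1ℙ = inj₁ (v∈cover-odd i i-parity)
    ... | 0ℙ with n ∸ k ≤? toℕ i
    ...   | yes tail = inj₁ (v∈cover-tail i tail)
    ...   | no ¬tail = inj₂ (v∈cover-odd (i +ₘ k) (trans (cong parity (toℕ-+ₘ i k no-wrap)) (parity-+ (toℕ i) k i-parity k-odd)))
      where
        no-wrap : toℕ i + k < n
        no-wrap = subst (toℕ i + k <_) (m∸n+n≡m k≤n) (+-monoˡ-< k (≰⇒> ¬tail))

cover-size : ∀ n k → k ≤ n → parity (n ∸ k) ≡ 0ℙ → size (cover n k) ≡ n + ⌈ k /2⌉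
cover-size n k k≤n d-even = begin
  size (cover n k)                           ≡⟨ cong₂ _+_ (∣subsetOf∣ n isEven) (∣subsetOf∣ n (innerChosen n k)) ⟩
  ∑< n (⟦_⟧ ∘ isEven) + ∑< n (⟦_⟧ ∘ chosen)   ≡⟨ sym (∑<-+ n (⟦_⟧ ∘ isEven) (⟦_⟧ ∘ chosen)) ⟩
  ∑< n perIndex                              ≡⟨ cong (λ m → ∑< m perIndex) (sym (m∸n+n≡m k≤n)) ⟩
  ∑< (d + k) perIndex                        ≡⟨ ∑<-split d k perIndex ⟩
  ∑< d perIndex + ∑< k (perIndex ∘ (d +_))   ≡⟨ cong₂ _+_ (∑<-cong d head) (∑<-cong k tail) ⟩
  ∑< d (λ _ → 1) + ∑< k (λ j → 1 + ⟦ isEven j ⟧)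
                                             ≡⟨ cong₂ _+_ (∑<-const d 1) (∑<-+ k (λ _ → 1) (⟦_⟧ ∘ isEven)) ⟩
  d * 1 + (∑< k (λ _ → 1) + ∑< k (⟦_⟧ ∘ isEven))
                                             ≡⟨ cong₂ (λ x y → x + (y + ∑< k (⟦_⟧ ∘ isEven))) (*-identityʳ d) (∑<-const k 1) ⟩
  d + (k * 1 + ∑< k (⟦_⟧ ∘ isEven))          ≡⟨ cong₂ (λ x y → d + (x + y)) (*-identityʳ k) (∑<-isEven k) ⟩
  d + (k + ⌈ k /2⌉)                          ≡⟨ sym (+-assoc d k _) ⟩
  d + k + ⌈ k /2⌉                            ≡⟨ cong (_+ ⌈ k /2⌉) (m∸n+n≡m k≤n) ⟩
  n + ⌈ k /2⌉                                ∎
  where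
    open ≡-Reasoning
    d = n ∸ k
    chosen = innerChosen n k
    perIndex : ℕ → ℕ
    perIndex i = ⟦ isEven i ⟧ + ⟦ chosen i ⟧

    head : ∀ i → i < d → perIndex i ≡ 1
    head i i<d rewrite dec-false (d ≤? i) (<⇒≱ i<d) | ∨-identityʳ (not (isEven i)) with isEven i
    ... | true  = refl
    ... | false = refl

    -- In the tail v_i is always chosen, and d + j is even iff j is.
    tail : ∀ j → j < k → perIndex (d + j) ≡ 1 + ⟦ isEven j ⟧
    tail j _ = begin
      ⟦ isEven (d + j) ⟧ + ⟦ chosen (d + j) ⟧ ≡⟨ cong₂ (λ p b → ⟦ even? p ⟧ + ⟦ b ⟧) (parity-+ d j d-even refl)
                                                       (trans (cong (not (isEven (d + j)) ∨_) (dec-true (d ≤? d + j) (m≤m+n d j))) (∨-zeroʳ _)) ⟩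
      ⟦ isEven j ⟧ + 1                        ≡⟨ +-comm ⟦ isEven j ⟧ 1 ⟩
      1 + ⟦ isEven j ⟧                        ∎

proposition10 : (n k : ℕ) .{{_ : NonZero n}} → 1 ≤ k → 2 * k < n →
    (Σ ℕ λ a → n ≡ 2 * a + 1) → (Σ ℕ λ b → k ≡ 2 * b + 1) →
    Σ (VertexSet n) λ S → IsVertexCover n k S × size S ≤ n + (k + 1) / 2
proposition10 n k _ 2k<n (a , n≡2a+1) (b , k≡2b+1) =
  cover n k , cover-isVertexCover n k k≤n n-odd k-odd , ≤-reflexive exact-size
  where
    k≤n : k ≤ n
    k≤n = ≤-trans (m≤m+n k (k + 0)) (<⇒≤ 2k<n)
    n-odd : parity n ≡ 1ℙ
    n-odd = trans (cong parity n≡2a+1) (parity-odd a)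
    k-odd : parity k ≡ 1ℙ
    k-odd = trans (cong parity k≡2b+1) (parity-odd b)
    exact-size : size (cover n k) ≡ n + (k + 1) / 2
    exact-size = trans (cover-size n k k≤n (parity-∸ k≤n n-odd k-odd)) (cong (n +_) (⌈m/2⌉≡[m+1]/2 k))
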